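{- Let $\varphi=\bigwedge_{r\in R}\forall x_1(\alpha_r\to\exists_{[n_r^{+p_r}]}x_2\,\gamma_r)\wedge\bigwedge_{t\in T}\forall x_1(\beta_t\to\neg\exists_{[n_t^{+p_t}]}x_2\,\delta_t)$ be a normal-form $\mathcal{FL}^2_{\text{PC}}$-sentence over $\sigma\cup\{=\}$, and let $\Psi=\Psi_1\cup\dots\cup\Psi_6$ be the system of (disjunctive) linear Diophantine inequations over $\mathbb{N}^*$ associated with $\varphi$ as described in the context. If $\varphi$ has a globally homogeneous model, then $\Psi$ has a solution over $\mathbb{N}^*$.
   Context: Fluted fragment with periodic counting ($\mathcal{FL}_{\text{PC}}$): variables $x_1,x_2$; signature finite relational $\sigma$ plus equality; $n^{+p}=\{n+ip:i\in\mathbb{N}\}$; $\mathfrak{A},a\models\exists_{[n^{+p}]}x_2\varphi$ iff $|\{b:\mathfrak{A},ab\models\varphi\}|$ is finite and in $n^{+p}$. Formulas of $\mathcal{FL}^{[1]}_{\text{PC}}$ quantifier-free: Boolean combinations of $p(x_1)$, $p$ unary; of $\mathcal{FL}^{[2]}_{\text{PC}}$ quantifier-free: Boolean combinations of $p(x_2)$ ($p$ unary) and $r(x_1,x_2)$ ($r\in\sigma\cup\{=\}$ binary); $\alpha_r,\beta_t$ are of the first kind and $\gamma_r,\delta_t$ of the second. $\mathrm{FTP}_1$ is the set of fluted 1-types: sets containing, for each unary $p\in\sigma$, exactly one of $p(x_1),\neg p(x_1)$. $\mathrm{FTP}_2$ is the set of fluted 2-types: sets containing exactly one of each atom/negation of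 the forms $p(x_2)$ ($p$ unary) and $r(x_1,x_2)$ ($r\in\sigma\cup\{=\}$ binary). For $\tau\in\mathrm{FTP}_2$, $\tau\restriction_{[2,2]}\in\mathrm{FTP}_1$ is obtained by keeping the unary literals of $\tau$ and renaming $x_2$ to $x_1$. Types are identified with conjunctions of their members, so $\pi\models\alpha$, $\tau\models\gamma$ make sense; ${=}\in\tau$ means $x_1=x_2\in\tau$. A structure is globally homogeneous if any two elements with the same fluted 1-type emit, for each $\tau\in\mathrm{FTP}_2$, the same number of $c$ with fluted 2-type of the pair equal to $\tau$. Arithmetic on $\mathbb{N}^*=\mathbb{N}\cup\{\aleph_0\}$: $\aleph_0$ is the maximum, $0\cdot\aleph_0=0$, $n+\aleph_0=\aleph_0$, $n\cdot\aleph_0=\aleph_0$ for $n\ne0$. Variables: $x_\pi$ ($\pi\in\mathrm{FTP}_1$), $y_{\pi,\tau}$ ($\pi\in\mathrm{FTP}_1,\tau\in\mathrm{FTP}_2$), $i_{\pi,r}$ ($r\in R$), $j_{\pi,t}$ ($t\in T$). $\Psi_1=\{\sum_\pi x_\pi\ge1\}$. $\Psi_2=\{x_\pi\ne0\to\sum_{\tau:\tau\restriction_{[2,2]}=\pi'}y_{\pi,\tau}=x_{\pi'} : \pi,\pi'\in\mathrm{FTP}_1\}$. $\Psi_3=\{x_\pi\ne0\to\sum_{\tau\models\gamma_r}y_{\pi,\tau}=n_r+i_{\pi,r}p_r : r\in R,\ \pi\models\alpha_r\}$. With $\Theta_1(\pi,t):=\sum_{\tau\models\delta_t}y_{\pi,\tau}<n_t$;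 $\Theta_2(\pi,t):=\sum_{\tau\models\delta_t}y_{\pi,\tau}=\aleph_0$; $\Theta_3(\pi,t):=(p_t=0)\wedge(n_t<\sum_{\tau\models\delta_t}y_{\pi,\tau})$; $\Theta_4(\pi,t):=n_t+j_{\pi,t}p_t<\sum_{\tau\models\delta_t}y_{\pi,\tau}<n_t+(j_{\pi,t}+1)p_t$, let $\Psi_4=\{x_\pi\ne0\to\bigvee_{k=1}^4\Theta_k(\pi,t): t\in T,\ \pi\models\beta_t\}$. $\Psi_5=\{y_{\pi,\tau}=0 : {=}\in\tau,\ \tau\restriction_{[2,2]}\ne\pi\}\cup\{\sum_{\tau:{=}\in\tau}y_{\pi,\tau}=1:\pi\in\mathrm{FTP}_1\}$. $\Psi_6=\{i_{\pi,r}<\aleph_0,\ j_{\pi,t}<\aleph_0 : \pi\in\mathrm{FTP}_1, r\in R,t\in T\}$. A solution is an assignment of values in $\mathbb{N}^*$ to all variables satisfying every (conditional/disjunctive) inequation. -}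

module Defs where

open import Data.Nat using (ℕ; zero; suc) renaming (_+_ to _+ℕ_; _*_ to _*ℕ_; _<_ to _<ℕ_)
open import Data.Bool using (Bool; true; false; _∧_; _∨_; not; if_then_else_)
open import Data.Fin using (Fin)
open import Data.Vec using (Vec; []; _∷_; lookup)
open import Data.List using (List; []; _∷_; _++_; map; concatMap)
open import Data.Product using (Σ; ∃; _×_; _,_)
open import Data.Sum using (_⊎_)
open import Data.Unit using (⊤)
open import Data.Empty using (⊥)
open import Relation.Nullary using (¬_)
open import Relation.Binary.PropositionalEquality using (_≡_; _≢_)

data ℕ* : Set where
  fin : ℕ → ℕ*
  ℵ₀  : ℕ*

infixl 6 _+*_
infixl 7 _·*_
infix 4 _<*_ _≤*_

_+*_ : ℕ* → ℕ* → ℕ*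
fin m +* fin n = fin (m +ℕ n)
fin m +* ℵ₀    = ℵ₀
ℵ₀    +* _     = ℵ₀

_·*_ : ℕ* → ℕ* → ℕ*
fin m       ·* fin n       = fin (m *ℕ n)
fin zero    ·* ℵ₀          = fin zero
fin (suc m) ·* ℵ₀          = ℵ₀
ℵ₀          ·* fin zero    = fin zero
ℵ₀          ·* fin (suc n) = ℵ₀
ℵ₀          ·* ℵ₀          = ℵ₀

data _<*_ : ℕ* → ℕ* → Set where
  fin<fin : ∀ {m n} → m <ℕ n → fin m <* fin n
  fin<ℵ₀  : ∀ {m} → fin m <* ℵ₀

_≤*_ : ℕ* → ℕ* → Set
x ≤* y = (x <* y) ⊎ (x ≡ y)

sum* : List ℕ* → ℕ*
sum* []       = fin 0
sum* (x ∷ xs) = x +* sum* xs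

record Structure (u b : ℕ) : Set₁ where
  field
    Dom    : Set
    elem   : Dom                      -- domains of structures are nonempty
    unary  : Fin u → Dom → Set
    binary : Fin b → Dom → Dom → Set

data QF1 (u : ℕ) : Set where
  atom : Fin u → QF1 u
  tt   : QF1 u
  neg  : QF1 u → QF1 u
  and  : QF1 u → QF1 u → QF1 u
  or   : QF1 u → QF1 u → QF1 u

data QF2 (u b : ℕ) : Set where
  atom₂ : Fin u → QF2 u b              -- p(x₂)
  rel   : Fin b → QF2 u b              -- r(x₁,x₂)
  eq    : QF2 u b
  tt    : QF2 u b
  neg   : QF2 u b → QF2 u b
  and   : QF2 u b → QF2 u b → QF2 u b
  or    : QF2 u b → QF2 u b → QF2 u b

module _ {u b : ℕ} (𝔄 : Structure u b) where
  open Structure 𝔄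

  sat1 : QF1 u → Dom → Set
  sat1 (atom p)  a = unary p a
  sat1 tt        a = ⊤
  sat1 (neg φ)   a = ¬ sat1 φ a
  sat1 (and φ ψ) a = sat1 φ a × sat1 ψ a
  sat1 (or φ ψ)  a = sat1 φ a ⊎ sat1 ψ a

  sat2 : QF2 u b → Dom → Dom → Set
  sat2 (atom₂ p) a c = unary p c
  sat2 (rel r)   a c = binary r a c
  sat2 eq        a c = a ≡ c
  sat2 tt        a c = ⊤
  sat2 (neg φ)   a c = ¬ sat2 φ a c
  sat2 (and φ ψ) a c = sat2 φ a c × sat2 ψ a c
  sat2 (or φ ψ)  a c = sat2 φ a c ⊎ sat2 ψ a c

record HasSize {A : Set} (P : A → Set) (k : ℕ) : Set where
  field
    enum     : Fin k → A
    injective : ∀ i j → enum i ≡ enum j → i ≡ j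
    sound    : ∀ i → P (enum i)
    complete : ∀ c → P c → Σ (Fin k) (λ i → enum i ≡ c)

_∈[_+_] : ℕ → ℕ → ℕ → Set
k ∈[ n + p ] = Σ ℕ (λ i → k ≡ n +ℕ i *ℕ p)

CountIn : {A : Set} → ℕ → ℕ → (A → Set) → Set
CountIn n p P = Σ ℕ (λ k → HasSize P k × k ∈[ n + p ])

-- {c | P c} and {c | Q c} have the same number of elements in ℕ*
-- (both infinite, or both finite of the same size)
SameCount : {A : Set} → (A → Set) → (A → Set) → Set
SameCount P Q = ∀ k → (HasSize P k → HasSize Q k) × (HasSize Q k → HasSize P k)

-- Normal-form FL²_PC sentences
--   ⋀_{r∈R} ∀x₁(α_r → ∃_[n_r^{+p_r}] x₂ γ_r) ∧ ⋀_{t∈T} ∀x₁(β_t → ¬∃_[n_t^{+p_t}] x₂ δ_t)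
-- with R = Fin nR, T = Fin nT.

record NormalForm (u b : ℕ) : Set where
  field
    nR : ℕ
    α  : Fin nR → QF1 u
    γ  : Fin nR → QF2 u b
    nr : Fin nR → ℕ
    pr : Fin nR → ℕ
    nT : ℕ
    β  : Fin nT → QF1 u
    δ  : Fin nT → QF2 u b
    nt : Fin nT → ℕ
    pt : Fin nT → ℕ

_⊨_ : {u b : ℕ} → Structure u b → NormalForm u b → Set
𝔄 ⊨ φ =
  (∀ r a → sat1 𝔄 (α r) a → CountIn (nr r) (pr r) (sat2 𝔄 (γ r) a)) ×
  (∀ t a → sat1 𝔄 (β t) a → ¬ CountIn (nt t) (pt t) (sat2 𝔄 (δ t) a))
  where open NormalForm φ

-- fluted 1-type: the i-th entry says whether p_i(x₁) holds
FTP1 : ℕ → Set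
FTP1 u = Vec Bool u

-- fluted 2-type: (unary literals p(x₂), binary literals r(x₁,x₂), x₁ = x₂)
record FTP2 (u b : ℕ) : Set where
  constructor ftp2
  field
    un  : Vec Bool u
    bin : Vec Bool b
    eqb : Bool

restrict : {u b : ℕ} → FTP2 u b → FTP1 u
restrict τ = FTP2.un τ

allVecs : (n : ℕ) → List (Vec Bool n)
allVecs zero    = [] ∷ []
allVecs (suc n) = map (true ∷_) (allVecs n) ++ map (false ∷_) (allVecs n)

allFTP1 : (u : ℕ) → List (FTP1 u)
allFTP1 u = allVecs u

allFTP2 : (u b : ℕ) → List (FTP2 u b)
allFTP2 u b =
  concatMap (λ v → concatMap (λ w → ftp2 v w true ∷ ftp2 v w false ∷ []) (allVecs b)) (allVecs u)

vecEq : {n : ℕ} → Vec Bool n → Vec Bool n → Bool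
vecEq []       []       = true
vecEq (x ∷ xs) (y ∷ ys) = (if x then y else not y) ∧ vecEq xs ys

evalT1 : {u : ℕ} → FTP1 u → QF1 u → Bool
evalT1 π (atom p)  = lookup π p
evalT1 π tt        = true
evalT1 π (neg φ)   = not (evalT1 π φ)
evalT1 π (and φ ψ) = evalT1 π φ ∧ evalT1 π ψ
evalT1 π (or φ ψ)  = evalT1 π φ ∨ evalT1 π ψ

evalT2 : {u b : ℕ} → FTP2 u b → QF2 u b → Bool
evalT2 τ (atom₂ p) = lookup (FTP2.un τ) p
evalT2 τ (rel r)   = lookup (FTP2.bin τ) r
evalT2 τ eq        = FTP2.eqb τ
evalT2 τ tt        = true
evalT2 τ (neg φ)   = not (evalT2 τ φ)
evalT2 τ (and φ ψ) = evalT2 τ φ ∧ evalT2 τ ψ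
evalT2 τ (or φ ψ)  = evalT2 τ φ ∨ evalT2 τ ψ

sumT2 : {u b : ℕ} → (FTP2 u b → Bool) → (FTP2 u b → ℕ*) → ℕ*
sumT2 {u} {b} cond f = sum* (concatMap (λ τ → if cond τ then f τ ∷ [] else []) (allFTP2 u b))

sumT1 : {u : ℕ} → (FTP1 u → ℕ*) → ℕ*
sumT1 {u} f = sum* (map f (allFTP1 u))

module _ {u b : ℕ} (𝔄 : Structure u b) where
  open Structure 𝔄

  Same1Type : Dom → Dom → Set
  Same1Type a a' = ∀ p → (unary p a → unary p a') × (unary p a' → unary p a)

  Has2Type : Dom → Dom → FTP2 u b → Set
  Has2Type a c τ =
    (∀ p → (unary p c → lookup (FTP2.un τ) p ≡ true) × (lookup (FTP2.un τ) p ≡ true → unary p c)) ×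
    (∀ r → (binary r a c → lookup (FTP2.bin τ) r ≡ true) × (lookup (FTP2.bin τ) r ≡ true → binary r a c)) ×
    ((a ≡ c → FTP2.eqb τ ≡ true) × (FTP2.eqb τ ≡ true → a ≡ c))

  GloballyHomogeneous : Set
  GloballyHomogeneous =
    ∀ a a' → Same1Type a a' → ∀ τ → SameCount (λ c → Has2Type a c τ) (λ c → Has2Type a' c τ)

record Assignment {u b : ℕ} (φ : NormalForm u b) : Set where
  open NormalForm φ
  field
    x : FTP1 u → ℕ*
    y : FTP1 u → FTP2 u b → ℕ*
    i : FTP1 u → Fin nR → ℕ*
    j : FTP1 u → Fin nT → ℕ*

module _ {u b : ℕ} (φ : NormalForm u b) (s : Assignment φ) where
  open NormalForm φ
  open Assignment s

  Ψ₁ : Set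
  Ψ₁ = fin 1 ≤* sumT1 x

  Ψ₂ : Set
  Ψ₂ = ∀ π π' → x π ≢ fin 0 →
         sumT2 (λ τ → vecEq (restrict τ) π') (y π) ≡ x π'

  Ψ₃ : Set
  Ψ₃ = ∀ r π → evalT1 π (α r) ≡ true → x π ≢ fin 0 →
         sumT2 (λ τ → evalT2 τ (γ r)) (y π) ≡ fin (nr r) +* i π r ·* fin (pr r)

  Θ₁ Θ₂ Θ₃ Θ₄ : FTP1 u → Fin nT → Set
  Θ₁ π t = sumT2 (λ τ → evalT2 τ (δ t)) (y π) <* fin (nt t)
  Θ₂ π t = sumT2 (λ τ → evalT2 τ (δ t)) (y π) ≡ ℵ₀
  Θ₃ π t = (pt t ≡ 0) × (fin (nt t) <* sumT2 (λ τ → evalT2 τ (δ t)) (y π))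
  Θ₄ π t = (fin (nt t) +* j π t ·* fin (pt t) <* sumT2 (λ τ → evalT2 τ (δ t)) (y π)) ×
           (sumT2 (λ τ → evalT2 τ (δ t)) (y π) <* fin (nt t) +* (j π t +* fin 1) ·* fin (pt t))

  Ψ₄ : Set
  Ψ₄ = ∀ t π → evalT1 π (β t) ≡ true → x π ≢ fin 0 →
         Θ₁ π t ⊎ Θ₂ π t ⊎ Θ₃ π t ⊎ Θ₄ π t

  Ψ₅ : Set
  Ψ₅ = (∀ π τ → FTP2.eqb τ ≡ true → vecEq (restrict τ) π ≡ false → y π τ ≡ fin 0) ×
       (∀ π → sumT2 (λ τ → FTP2.eqb τ) (y π) ≡ fin 1)

  Ψ₆ : Set
  Ψ₆ = (∀ π r → i π r <* ℵ₀) × (∀ π t → j π t <* ℵ₀)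

  IsSolution : Set
  IsSolution = Ψ₁ × Ψ₂ × Ψ₃ × Ψ₄ × Ψ₅ × Ψ₆

-- With excluded middle every predicate on a structure has a cardinality in ℕ*, and the
-- intended solution is read off a model 𝔄: x_π is the number of elements of fluted 1-type π,
-- and y_{π,τ} the number of c such that (a, c) has fluted 2-type τ, for one chosen element a of
-- type π. Summing y_{π,τ} over the 2-types satisfying a formula then counts its witnesses at a,
-- so Ψ₂ counts the elements of type π', Ψ₃ and Ψ₄ are the counting conditions of 𝔄 (with
-- i_{π,r}, j_{π,t} the position of that count in n^{+p}), and Ψ₅ says that exactly one c equals
-- a.
module Submission where

open import Defs
open import Level using (0ℓ)
open import Data.Nat using (ℕ; zero; suc; _+_; _*_; _∸_; _≤_; _<_; s≤s; z≤n)
open import Data.Nat.Properties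
  using (≤-antisym; _<?_; ≮⇒≥; ≤∧≢⇒<; m+[n∸m]≡n; m+n∸m≡n; *-zeroʳ; +-comm; +-identityʳ;
         +-monoʳ-<; +-monoˡ-<; m<n+m; n≢0⇒n>0)
open import Data.Nat.DivMod using (_/_; _%_; m≡m%n+[m/n]*n; m%n<n; m*n/n≡m)
open import Data.Fin using (Fin; zero; suc; splitAt; join)
open import Data.Fin.Properties using (¬Fin0; injective⇒≤; splitAt-join; join-splitAt; suc-injective; 0≢1+n)
open import Data.Product using (Σ; ∃; _×_; _,_; proj₁; proj₂)
open import Data.Sum using (_⊎_; inj₁; inj₂; [_,_])
open import Data.Bool using (Bool; true; false; if_then_else_)
open import Data.Bool.Properties using (not-¬)
open import Data.Vec using (Vec; []; _∷_; lookup; tabulate; replicate)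
open import Data.Vec.Properties using (∷-injectiveʳ; lookup∘tabulate)
open import Data.List using (List; []; _∷_; map; concatMap)
open import Data.List.Relation.Unary.All as All using (All)
open import Data.List.Relation.Unary.Any using (here; there)
open import Data.List.Relation.Unary.Unique.Propositional using (Unique)
import Data.List.Relation.Unary.Unique.Propositional.Properties as Unique
open import Data.List.Membership.Propositional using (_∈_; find; lose)
open import Data.List.Membership.Propositional.Properties
  using (∈-++⁺ˡ; ∈-++⁺ʳ; ∈-map⁺; ∈-map⁻; ∈-concatMap⁺; ∈-concatMap⁻)
open import Data.Empty using (⊥-elim)
open import Data.Unit using (⊤; tt)
open import Function using (_∘_)
open import Relation.Nullary using (¬_; Dec; yes; no; does; proof)
open import Relation.Nullary.Reflects
  using (Reflects; ofʸ; ofⁿ; invert; det; ¬-reflects; _×-reflects_; _⊎-reflects_)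
open import Relation.Unary using (Pred; _⊆_; _≐_; _∪_; _∩_; _∖_; Empty; ｛_｝)
open import Relation.Binary.PropositionalEquality
  using (_≡_; _≢_; refl; sym; trans; cong; subst; subst₂; module ≡-Reasoning)
open import Axiom.ExcludedMiddle using (ExcludedMiddle)

open HasSize

module _ {A : Set} where

  HasSize-≤ : ∀ {P : Pred A 0ℓ} {k k'} → HasSize P k → HasSize P k' → k ≤ k'
  HasSize-≤ h h' = injective⇒≤ {f = index} index-injective
    where
    index : Fin _ → Fin _
    index i = proj₁ (complete h' (enum h i) (sound h i))
    enum-index : ∀ i → enum h' (index i) ≡ enum h i
    enum-index i = proj₂ (complete h' (enum h i) (sound h i))
    index-injective : ∀ {i j} → index i ≡ index j → i ≡ j
    index-injective {i} {j} e = injective h i j (begin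
      enum h i          ≡⟨ enum-index i ⟨
      enum h' (index i) ≡⟨ cong (enum h') e ⟩
      enum h' (index j) ≡⟨ enum-index j ⟩
      enum h j          ∎)
      where open ≡-Reasoning

  HasSize-unique : ∀ {P : Pred A 0ℓ} {k k'} → HasSize P k → HasSize P k' → k ≡ k'
  HasSize-unique h h' = ≤-antisym (HasSize-≤ h h') (HasSize-≤ h' h)

  HasSize-cong : ∀ {P Q : Pred A 0ℓ} {k} → P ≐ Q → HasSize P k → HasSize Q k
  HasSize-cong (P⊆Q , Q⊆P) h = record
    { enum = enum h ; injective = injective h
    ; sound = P⊆Q ∘ sound h ; complete = λ c → complete h c ∘ Q⊆P }

  HasSize-∅ : ∀ {P : Pred A 0ℓ} → Empty P → HasSize P 0
  HasSize-∅ empty = record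
    { enum = λ () ; injective = λ () ; sound = λ () ; complete = λ c p → ⊥-elim (empty c p) }

  HasSize-｛｝ : (e : A) → HasSize ｛ e ｝ 1
  HasSize-｛｝ e = record
    { enum = λ _ → e ; injective = λ { zero zero _ → refl }
    ; sound = λ _ → refl ; complete = λ c e≡c → zero , e≡c }

  HasSize-∪ : ∀ {P Q : Pred A 0ℓ} {m n} → Empty (P ∩ Q) →
              HasSize P m → HasSize Q n → HasSize (P ∪ Q) (m + n)
  HasSize-∪ {P} {Q} {m} {n} disjoint hp hq = record
    { enum = enum∪ ∘ splitAt m ; injective = injective-∪
    ; sound = sound∪ ∘ splitAt m ; complete = complete-∪ }
    where
    enum∪ : Fin m ⊎ Fin n → A
    enum∪ = [ enum hp , enum hq ]
    sound∪ : ∀ s → (P ∪ Q) (enum∪ s)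
    sound∪ (inj₁ i) = inj₁ (sound hp i)
    sound∪ (inj₂ j) = inj₂ (sound hq j)
    enum∪-injective : ∀ s t → enum∪ s ≡ enum∪ t → s ≡ t
    enum∪-injective (inj₁ i) (inj₁ j) e = cong inj₁ (injective hp i j e)
    enum∪-injective (inj₂ i) (inj₂ j) e = cong inj₂ (injective hq i j e)
    enum∪-injective (inj₁ i) (inj₂ j) e = ⊥-elim (disjoint _ (sound hp i , subst Q (sym e) (sound hq j)))
    enum∪-injective (inj₂ i) (inj₁ j) e = ⊥-elim (disjoint _ (sound hp j , subst Q e (sound hq i)))
    injective-∪ : ∀ i j → enum∪ (splitAt m i) ≡ enum∪ (splitAt m j) → i ≡ j
    injective-∪ i j e = begin
      i                        ≡⟨ join-splitAt m n i ⟨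
      join m n (splitAt m i)   ≡⟨ cong (join m n) (enum∪-injective (splitAt m i) (splitAt m j) e) ⟩
      join m n (splitAt m j)   ≡⟨ join-splitAt m n j ⟩
      j                        ∎
      where open ≡-Reasoning
    complete-index : ∀ s {c} → enum∪ s ≡ c → Σ (Fin (m + n)) (λ i → enum∪ (splitAt m i) ≡ c)
    complete-index s e = join m n s , trans (cong enum∪ (splitAt-join m n s)) e
    complete-∪ : ∀ c → (P ∪ Q) c → Σ (Fin (m + n)) (λ i → enum∪ (splitAt m i) ≡ c)
    complete-∪ c (inj₁ p) = let (i , e) = complete hp c p in complete-index (inj₁ i) e
    complete-∪ c (inj₂ q) = let (j , e) = complete hq c q in complete-index (inj₂ j) e

  HasSize-∖-head : ∀ {P : Pred A 0ℓ} {k} (h : HasSize P (suc k)) → HasSize (P ∖ ｛ enum h zero ｝) k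
  HasSize-∖-head {P} {k} h = record
    { enum = enum h ∘ suc
    ; injective = λ i j → suc-injective ∘ injective h (suc i) (suc j)
    ; sound = λ i → sound h (suc i) , 0≢1+n ∘ injective h zero (suc i)
    ; complete = complete-tail }
    where
    complete-tail : ∀ c → (P ∖ ｛ enum h zero ｝) c → Σ (Fin k) (λ i → enum h (suc i) ≡ c)
    complete-tail c (p , c≢head) with complete h c p
    ... | zero  , e = ⊥-elim (c≢head e)
    ... | suc i , e = i , e

Finite : {A : Set} → Pred A 0ℓ → Set
Finite P = ∃ (HasSize P)

concatMap⁺ : {A B : Set} {h : A → List B} (key : B → A) → (∀ {x z} → z ∈ h x → key z ≡ x) →
             (∀ x → Unique (h x)) → ∀ {xs} → Unique xs → Unique (concatMap h xs)
concatMap⁺ key fibre unique-h Unique.[] = Unique.[]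
concatMap⁺ {h = h} key fibre unique-h {x ∷ xs} (x∉xs Unique.∷ unique-xs) =
  Unique.++⁺ (unique-h x) (concatMap⁺ key fibre unique-h unique-xs) disjoint
  where
  disjoint : ∀ {z} → ¬ (z ∈ h x × z ∈ concatMap h xs)
  disjoint (z∈hx , z∈rest) with find (∈-concatMap⁻ h {xs = xs} z∈rest)
  ... | y , y∈xs , z∈hy = All.lookup x∉xs y∈xs (trans (sym (fibre z∈hx)) (fibre z∈hy))

allVecs-unique : ∀ n → Unique (allVecs n)
allVecs-unique zero    = All.[] Unique.∷ Unique.[]
allVecs-unique (suc n) = Unique.++⁺ (Unique.map⁺ ∷-injectiveʳ (allVecs-unique n))
                                    (Unique.map⁺ ∷-injectiveʳ (allVecs-unique n)) disjoint
  where
  disjoint : ∀ {v} → ¬ (v ∈ map (true ∷_) (allVecs n) × v ∈ map (false ∷_) (allVecs n))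
  disjoint (v∈t , v∈f) with ∈-map⁻ (true ∷_) v∈t | ∈-map⁻ (false ∷_) v∈f
  ... | _ , _ , refl | _ , _ , ()

allVecs-complete : ∀ {n} (v : Vec Bool n) → v ∈ allVecs n
allVecs-complete []          = here refl
allVecs-complete (true ∷ v)  = ∈-++⁺ˡ (∈-map⁺ (true ∷_) (allVecs-complete v))
allVecs-complete (false ∷ v) = ∈-++⁺ʳ _ (∈-map⁺ (false ∷_) (allVecs-complete v))

module _ {u b : ℕ} where

  private
    withEq : Vec Bool u → Vec Bool b → List (FTP2 u b)
    withEq v w = ftp2 v w true ∷ ftp2 v w false ∷ []

    withBin : Vec Bool u → List (FTP2 u b)
    withBin v = concatMap (withEq v) (allVecs b)

    ∈-withEq : ∀ {v w τ} → τ ∈ withEq v w → FTP2.un τ ≡ v × FTP2.bin τ ≡ w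
    ∈-withEq (here refl)         = refl , refl
    ∈-withEq (there (here refl)) = refl , refl

    ∈-withBin : ∀ {v τ} → τ ∈ withBin v → FTP2.un τ ≡ v
    ∈-withBin τ∈ with find (∈-concatMap⁻ (withEq _) {xs = allVecs b} τ∈)
    ... | _ , _ , τ∈withEq = proj₁ (∈-withEq τ∈withEq)

  allFTP2-unique : Unique (allFTP2 u b)
  allFTP2-unique =
    concatMap⁺ FTP2.un ∈-withBin
      (λ v → concatMap⁺ FTP2.bin (proj₂ ∘ ∈-withEq)
               (λ w → ((λ ()) All.∷ All.[]) Unique.∷ (All.[] Unique.∷ Unique.[]))
               (allVecs-unique b))
      (allVecs-unique u)

  allFTP2-complete : (τ : FTP2 u b) → τ ∈ allFTP2 u b
  allFTP2-complete (ftp2 v w e) =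
    ∈-concatMap⁺ withBin (lose (allVecs-complete v)
      (∈-concatMap⁺ (withEq v) (lose (allVecs-complete w) (∈-withEq-complete e))))
    where
    ∈-withEq-complete : ∀ e → ftp2 v w e ∈ withEq v w
    ∈-withEq-complete true  = here refl
    ∈-withEq-complete false = there (here refl)

-- ⌊(k ∸ n) / p⌋, the index of the last term of n^{+p} not above k (0 when p = 0).
progressionIndex : ℕ → ℕ → ℕ → ℕ
progressionIndex k n zero    = 0
progressionIndex k n (suc p) = (k ∸ n) / suc p

∈[+]⇒≡progressionIndex : ∀ {k n p} → k ∈[ n + p ] → k ≡ n + progressionIndex k n p * p
∈[+]⇒≡progressionIndex {n = n} {zero}  (i , refl) = cong (n +_) (*-zeroʳ i)
∈[+]⇒≡progressionIndex {n = n} {suc p} (i , refl) =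
  cong (λ j → n + j * suc p) (sym (begin
    (n + i * suc p ∸ n) / suc p ≡⟨ cong (_/ suc p) (m+n∸m≡n n (i * suc p)) ⟩
    i * suc p / suc p           ≡⟨ m*n/n≡m i (suc p) ⟩
    i                           ∎))
  where open ≡-Reasoning

∉[+]⇒between : ∀ k n p → ¬ k ∈[ n + p ] →
               k < n ⊎ (p ≡ 0 × n < k) ⊎
               (n + progressionIndex k n p * p < k × k < n + (progressionIndex k n p + 1) * p)
∉[+]⇒between k n p k∉ with k <? n
... | yes k<n = inj₁ k<n
... | no  k≮n = inj₂ (above-start p k∉)
  where
  n≤k : n ≤ k
  n≤k = ≮⇒≥ k≮n

  above-start : ∀ p → ¬ k ∈[ n + p ] →
                (p ≡ 0 × n < k) ⊎
                (n + progressionIndex k n p * p < k × k < n + (progressionIndex k n p + 1) * p)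
  above-start zero k∉ =
    inj₁ (refl , ≤∧≢⇒< n≤k (λ n≡k → k∉ (0 , trans (sym n≡k) (sym (+-identityʳ n)))))
  above-start (suc p) k∉ = inj₂ (lower , upper)
    where
    q = (k ∸ n) / suc p
    r = (k ∸ n) % suc p
    k≡ : k ≡ n + (r + q * suc p)
    k≡ = trans (sym (m+[n∸m]≡n n≤k)) (cong (n +_) (m≡m%n+[m/n]*n (k ∸ n) (suc p)))
    r≢0 : r ≢ 0
    r≢0 r≡0 = k∉ (q , trans k≡ (cong (λ r → n + (r + q * suc p)) r≡0))
    lower : n + q * suc p < k
    lower = subst (n + q * suc p <_) (sym k≡) (+-monoʳ-< n (m<n+m (q * suc p) (n≢0⇒n>0 r≢0)))
    upper : k < n + (q + 1) * suc p
    upper = subst₂ _<_ (sym k≡) (cong (λ j → n + j * suc p) (+-comm 1 q))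
                   (+-monoʳ-< n (+-monoˡ-< (q * suc p) (m%n<n (k ∸ n) (suc p))))

-- On ℵ₀ the index is a junk value; it only has to be finite (Ψ₆).
progressionIndex* : ℕ* → ℕ → ℕ → ℕ
progressionIndex* (fin k) = progressionIndex k
progressionIndex* ℵ₀      = λ _ _ → 0

≡fin-in-progression : ∀ {S k n p} → S ≡ fin k → k ∈[ n + p ] →
                      S ≡ fin n +* fin (progressionIndex* S n p) ·* fin p
≡fin-in-progression refl k∈ = cong fin (∈[+]⇒≡progressionIndex k∈)

outside-progression : ∀ S n p → (∀ {k} → S ≡ fin k → ¬ k ∈[ n + p ]) →
  let J = fin (progressionIndex* S n p) in
  (S <* fin n) ⊎ (S ≡ ℵ₀) ⊎ ((p ≡ 0) × (fin n <* S)) ⊎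
  ((fin n +* J ·* fin p <* S) × (S <* fin n +* (J +* fin 1) ·* fin p))
outside-progression ℵ₀      n p _  = inj₂ (inj₁ refl)
outside-progression (fin k) n p k∉ with ∉[+]⇒between k n p (k∉ refl)
... | inj₁ k<n                    = inj₁ (fin<fin k<n)
... | inj₂ (inj₁ (p≡0 , n<k))     = inj₂ (inj₂ (inj₁ (p≡0 , fin<fin n<k)))
... | inj₂ (inj₂ (lower , upper)) = inj₂ (inj₂ (inj₂ (fin<fin lower , fin<fin upper)))

≢0⇒1≤* : ∀ {z} → z ≢ fin 0 → fin 1 ≤* z
≢0⇒1≤* {fin zero}          z≢0 = ⊥-elim (z≢0 refl)
≢0⇒1≤* {fin (suc zero)}    z≢0 = inj₂ refl
≢0⇒1≤* {fin (suc (suc k))} z≢0 = inj₁ (fin<fin (s≤s (s≤s z≤n)))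
≢0⇒1≤* {ℵ₀}                z≢0 = inj₁ fin<ℵ₀

+*-≡0 : ∀ x y → x +* y ≡ fin 0 → x ≡ fin 0 × y ≡ fin 0
+*-≡0 (fin zero)    (fin zero)    _  = refl , refl
+*-≡0 (fin zero)    (fin (suc n)) ()
+*-≡0 (fin (suc m)) (fin n)       ()
+*-≡0 (fin m)       ℵ₀            ()
+*-≡0 ℵ₀            y             ()

sum*-≡0 : ∀ {xs z} → sum* xs ≡ fin 0 → z ∈ xs → z ≡ fin 0
sum*-≡0 {x ∷ xs} e (here refl) = proj₁ (+*-≡0 x (sum* xs) e)
sum*-≡0 {x ∷ xs} e (there z∈)  = sum*-≡0 (proj₂ (+*-≡0 x (sum* xs) e)) z∈

module _ {A : Set} {b : Bool} where

  reflects-true⁺ : Reflects A b → A → b ≡ true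
  reflects-true⁺ r a = det r (ofʸ a)

  reflects-true⁻ : Reflects A b → b ≡ true → A
  reflects-true⁻ r refl = invert r

∷-reflects : ∀ {A : Set} {n} {x : A} {v w : Vec A n} {b} →
             Reflects (v ≡ w) b → Reflects (x ∷ v ≡ x ∷ w) b
∷-reflects (ofʸ refl) = ofʸ refl
∷-reflects (ofⁿ v≢w)  = ofⁿ (v≢w ∘ ∷-injectiveʳ)

vecEq-reflects : ∀ {n} (v w : Vec Bool n) → Reflects (v ≡ w) (vecEq v w)
vecEq-reflects []          []          = ofʸ refl
vecEq-reflects (true ∷ v)  (true ∷ w)  = ∷-reflects (vecEq-reflects v w)
vecEq-reflects (true ∷ v)  (false ∷ w) = ofⁿ λ ()
vecEq-reflects (false ∷ v) (true ∷ w)  = ofⁿ λ ()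
vecEq-reflects (false ∷ v) (false ∷ w) = ∷-reflects (vecEq-reflects v w)

module Classical (em : ExcludedMiddle 0ℓ) where

  -- Excluded middle decides, for each element of the enumeration of Q in turn, whether it lies in P.
  Finite-⊆ : ∀ {A : Set} {P Q : Pred A 0ℓ} {k} → P ⊆ Q → HasSize Q k → Finite P
  Finite-⊆ {k = zero} P⊆Q hQ = 0 , HasSize-∅ (λ c p → ¬Fin0 (proj₁ (complete hQ c (P⊆Q p))))
  Finite-⊆ {P = P} {k = suc k} P⊆Q hQ =
    add-head em (Finite-⊆ (λ (p , p≢head) → P⊆Q p , p≢head) (HasSize-∖-head hQ))
    where
    head = enum hQ zero
    split : P ⊆ ｛ head ｝ ∪ (P ∖ ｛ head ｝)
    split {c} p with em {head ≡ c}
    ... | yes head≡c = inj₁ head≡c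
    ... | no  head≢c = inj₂ (p , head≢c)
    add-head : Dec (P head) → Finite (P ∖ ｛ head ｝) → Finite P
    add-head (yes p-head) (m , hP∖) =
      suc m , HasSize-cong ([ (λ { refl → p-head }) , proj₁ ] , split)
                           (HasSize-∪ (λ c (head≡c , _ , head≢c) → head≢c head≡c)
                                      (HasSize-｛｝ head) hP∖)
    add-head (no ¬p-head) (m , hP∖) =
      m , HasSize-cong (proj₁ , λ p → p , λ { refl → ¬p-head p }) hP∖

  data Count {A : Set} (P : Pred A 0ℓ) : ℕ* → Set where
    finite   : ∀ {k} → HasSize P k → Count P (fin k)
    infinite : ¬ Finite P → Count P ℵ₀

  private
    size : {A : Set} {P : Pred A 0ℓ} → Dec (Finite P) → ℕ*
    size (yes (k , _)) = fin k
    size (no _)        = ℵ₀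

    size-Count : {A : Set} {P : Pred A 0ℓ} (d : Dec (Finite P)) → Count P (size d)
    size-Count (yes (k , h)) = finite h
    size-Count (no ¬fin)     = infinite ¬fin

  count : {A : Set} → Pred A 0ℓ → ℕ*
  count P = size (em {Finite P})

  count-view : {A : Set} (P : Pred A 0ℓ) → Count P (count P)
  count-view P = size-Count em

  module _ {A : Set} where

    count-fin : ∀ {P : Pred A 0ℓ} {k} → HasSize P k → count P ≡ fin k
    count-fin {P} h with count P | count-view P
    ... | _ | finite h'    = cong fin (HasSize-unique h' h)
    ... | _ | infinite ¬fin = ⊥-elim (¬fin (_ , h))

    count-fin⁻ : ∀ {P : Pred A 0ℓ} {k} → count P ≡ fin k → HasSize P k
    count-fin⁻ {P} e with count P | count-view P
    count-fin⁻ refl | _ | finite h = h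

    count-∞ : ∀ {P : Pred A 0ℓ} → ¬ Finite P → count P ≡ ℵ₀
    count-∞ {P} ¬fin with count P | count-view P
    ... | _ | finite h   = ⊥-elim (¬fin (_ , h))
    ... | _ | infinite _ = refl

    count≡0⇒Empty : ∀ {P : Pred A 0ℓ} → count P ≡ fin 0 → Empty P
    count≡0⇒Empty e c p = ¬Fin0 (proj₁ (complete (count-fin⁻ e) c p))

    count-cong : ∀ {P Q : Pred A 0ℓ} → P ≐ Q → count P ≡ count Q
    count-cong {P} {Q} (P⊆Q , Q⊆P) with count P | count-view P
    ... | _ | finite h      = sym (count-fin (HasSize-cong (P⊆Q , Q⊆P) h))
    ... | _ | infinite ¬fin = sym (count-∞ λ (k , h) → ¬fin (k , HasSize-cong (Q⊆P , P⊆Q) h))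

    count-∪ : ∀ {P Q : Pred A 0ℓ} → Empty (P ∩ Q) → count (P ∪ Q) ≡ count P +* count Q
    count-∪ {P} {Q} disjoint with count P | count-view P | count Q | count-view Q
    ... | _ | finite hP | _ | finite hQ = count-fin (HasSize-∪ disjoint hP hQ)
    ... | _ | finite _  | _ | infinite ¬fin = count-∞ λ (_ , h) → ¬fin (Finite-⊆ inj₂ h)
    ... | _ | infinite ¬fin | _ | _ = count-∞ λ (_ , h) → ¬fin (Finite-⊆ inj₁ h)

  profile : {A D : Set} → (D → A) → A → ℕ*
  profile f τ = count (λ c → f c ≡ τ)

  sum-profile : ∀ {A D : Set} (f : D → A) (cond : A → Bool) {L} → Unique L →
                sum* (concatMap (λ τ → if cond τ then profile f τ ∷ [] else []) L) ≡
                count (λ c → f c ∈ L × cond (f c) ≡ true)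
  sum-profile f cond Unique.[] = sym (count-fin (HasSize-∅ λ { _ (() , _) }))
  sum-profile f cond {τ ∷ L} (τ∉L Unique.∷ unique-L) with cond τ in cond-τ
  ... | true = begin
    profile f τ +* sum* (concatMap (λ σ → if cond σ then profile f σ ∷ [] else []) L)
      ≡⟨ cong (profile f τ +*_) (sum-profile f cond unique-L) ⟩
    profile f τ +* count (λ c → f c ∈ L × cond (f c) ≡ true)
      ≡⟨ count-∪ disjoint ⟨
    count (λ c → f c ≡ τ ⊎ (f c ∈ L × cond (f c) ≡ true))
      ≡⟨ count-cong (to , from) ⟩
    count (λ c → f c ∈ τ ∷ L × cond (f c) ≡ true)
      ∎
    where
    open ≡-Reasoning
    disjoint : ∀ c → ¬ (f c ≡ τ × f c ∈ L × cond (f c) ≡ true)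
    disjoint c (refl , fc∈L , _) = All.lookup τ∉L fc∈L refl
    to : ∀ {c} → f c ≡ τ ⊎ (f c ∈ L × cond (f c) ≡ true) → f c ∈ τ ∷ L × cond (f c) ≡ true
    to (inj₁ refl)              = here refl , cond-τ
    to (inj₂ (fc∈L , cond-fc))  = there fc∈L , cond-fc
    from : ∀ {c} → f c ∈ τ ∷ L × cond (f c) ≡ true → f c ≡ τ ⊎ (f c ∈ L × cond (f c) ≡ true)
    from (here fc≡τ , _)        = inj₁ fc≡τ
    from (there fc∈L , cond-fc) = inj₂ (fc∈L , cond-fc)
  ... | false = trans (sum-profile f cond unique-L) (count-cong (to , from))
    where
    to : ∀ {c} → f c ∈ L × cond (f c) ≡ true → f c ∈ τ ∷ L × cond (f c) ≡ true
    to (fc∈L , cond-fc) = there fc∈L , cond-fc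
    from : ∀ {c} → f c ∈ τ ∷ L × cond (f c) ≡ true → f c ∈ L × cond (f c) ≡ true
    from (here refl , cond-fc)  = ⊥-elim (not-¬ cond-τ cond-fc)
    from (there fc∈L , cond-fc) = fc∈L , cond-fc

  sumT2-profile : ∀ {u b} {D : Set} (f : D → FTP2 u b) (cond : FTP2 u b → Bool) →
                  sumT2 cond (profile f) ≡ count (λ c → cond (f c) ≡ true)
  sumT2-profile f cond =
    trans (sum-profile f cond allFTP2-unique) (count-cong (proj₂ , λ cond-fc → allFTP2-complete (f _) , cond-fc))

  holds : Set → Bool
  holds P = does (em {P})

  module FlutedTypes {u b : ℕ} (𝔄 : Structure u b) where
    open Structure 𝔄

    type₁ : Dom → FTP1 u
    type₁ a = tabulate (λ p → holds (unary p a))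

    type₂ : Dom → Dom → FTP2 u b
    type₂ a c = ftp2 (type₁ c) (tabulate (λ r → holds (binary r a c))) (holds (a ≡ c))

    lookup-reflects : ∀ {n} (P : Fin n → Set) i → Reflects (P i) (lookup (tabulate (holds ∘ P)) i)
    lookup-reflects P i = subst (Reflects (P i)) (sym (lookup∘tabulate (holds ∘ P) i)) (proof em)

    sat1-reflects : ∀ α a → Reflects (sat1 𝔄 α a) (evalT1 (type₁ a) α)
    sat1-reflects (atom p)  a = lookup-reflects (λ q → unary q a) p
    sat1-reflects tt        a = ofʸ _
    sat1-reflects (neg α)   a = ¬-reflects (sat1-reflects α a)
    sat1-reflects (and α β) a = sat1-reflects α a ×-reflects sat1-reflects β a
    sat1-reflects (or α β)  a = sat1-reflects α a ⊎-reflects sat1-reflects β a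

    sat2-reflects : ∀ γ a c → Reflects (sat2 𝔄 γ a c) (evalT2 (type₂ a c) γ)
    sat2-reflects (atom₂ p) a c = lookup-reflects (λ q → unary q c) p
    sat2-reflects (rel r)   a c = lookup-reflects (λ q → binary q a c) r
    sat2-reflects eq        a c = proof em
    sat2-reflects tt        a c = ofʸ _
    sat2-reflects (neg γ)   a c = ¬-reflects (sat2-reflects γ a c)
    sat2-reflects (and γ δ) a c = sat2-reflects γ a c ×-reflects sat2-reflects δ a c
    sat2-reflects (or γ δ)  a c = sat2-reflects γ a c ⊎-reflects sat2-reflects δ a c

  module Solution {u b : ℕ} (φ : NormalForm u b) (𝔄 : Structure u b) (model : 𝔄 ⊨ φ) where
    open Structure 𝔄
    open NormalForm φ
    open FlutedTypes 𝔄

    Realised : FTP1 u → Set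
    Realised π = ∃ λ a → type₁ a ≡ π

    multiplicity : FTP1 u → ℕ*
    multiplicity π = count (λ a → type₁ a ≡ π)

    -- An unrealised π has multiplicity 0, so only Ψ₅ constrains its row; it is met by the
    -- row of an imaginary lone element of type π.
    Emitter : {π : FTP1 u} → Dec (Realised π) → Set
    Emitter (yes _) = Dom
    Emitter (no _)  = ⊤

    emitted : ∀ {π} (d : Dec (Realised π)) → Emitter d → FTP2 u b
    emitted (yes (a , _)) = type₂ a
    emitted {π} (no _)    = λ _ → ftp2 π (replicate b false) true

    row : FTP1 u → FTP2 u b → ℕ*
    row π = profile (emitted (em {Realised π}))

    rowSum : FTP1 u → QF2 u b → ℕ*
    rowSum π γ = sumT2 (λ τ → evalT2 τ γ) (row π)

    assignment : Assignment φ
    assignment = record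
      { x = multiplicity
      ; y = row
      ; i = λ π r → fin (progressionIndex* (rowSum π (γ r)) (nr r) (pr r))
      ; j = λ π t → fin (progressionIndex* (rowSum π (δ t)) (nt t) (pt t))
      }

    realised-row : ∀ {π} (d : Dec (Realised π)) → multiplicity π ≢ fin 0 →
                   ∃ λ a → type₁ a ≡ π ×
                     (∀ cond → sumT2 cond (profile (emitted d)) ≡ count (λ c → cond (type₂ a c) ≡ true))
    realised-row (yes (a , a∈π)) _   = a , a∈π , sumT2-profile (type₂ a)
    realised-row (no ¬realised)  π≢0 =
      ⊥-elim (π≢0 (count-fin (HasSize-∅ λ a a∈π → ¬realised (a , a∈π))))

    realised-rowSum : ∀ {π} → multiplicity π ≢ fin 0 →
                      ∃ λ a → type₁ a ≡ π × (∀ γ → rowSum π γ ≡ count (sat2 𝔄 γ a))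
    realised-rowSum π≢0 with realised-row em π≢0
    ... | a , a∈π , sum≡ = a , a∈π , λ γ → trans (sum≡ _)
            (count-cong (reflects-true⁻ (sat2-reflects γ a _) , reflects-true⁺ (sat2-reflects γ a _)))

    emitted-reflexive : ∀ {π} (d : Dec (Realised π)) c →
                        FTP2.eqb (emitted d c) ≡ true → restrict (emitted d c) ≡ π
    emitted-reflexive (yes (a , refl)) c a≡c = cong type₁ (sym (reflects-true⁻ (proof em) a≡c))
    emitted-reflexive (no _)           c _   = refl

    emitted-reflexive-once : ∀ {π} (d : Dec (Realised π)) → HasSize (λ c → FTP2.eqb (emitted d c) ≡ true) 1
    emitted-reflexive-once (yes (a , _)) =
      HasSize-cong (reflects-true⁺ (proof em) , reflects-true⁻ (proof em)) (HasSize-｛｝ a)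
    emitted-reflexive-once (no _) = HasSize-cong ((λ _ → refl) , (λ _ → refl)) (HasSize-｛｝ tt)

    ψ₁ : Ψ₁ φ assignment
    ψ₁ = ≢0⇒1≤* λ sum≡0 →
      count≡0⇒Empty (sum*-≡0 sum≡0 (∈-map⁺ multiplicity (allVecs-complete (type₁ elem)))) elem refl

    ψ₂ : Ψ₂ φ assignment
    ψ₂ π π' π≢0 with realised-row em π≢0
    ... | a , _ , sum≡ = trans (sum≡ _)
            (count-cong (reflects-true⁻ (vecEq-reflects _ π') , reflects-true⁺ (vecEq-reflects _ π')))

    ψ₃ : Ψ₃ φ assignment
    ψ₃ r π α-holds π≢0 with realised-rowSum π≢0
    ... | a , refl , rowSum≡ with proj₁ model r a (reflects-true⁻ (sat1-reflects (α r) a) α-holds)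
    ... | k , hk , k∈ = ≡fin-in-progression (trans (rowSum≡ (γ r)) (count-fin hk)) k∈

    ψ₄ : Ψ₄ φ assignment
    ψ₄ t π β-holds π≢0 with realised-rowSum π≢0
    ... | a , refl , rowSum≡ = outside-progression (rowSum (type₁ a) (δ t)) (nt t) (pt t) λ S≡k k∈ →
            proj₂ model t a (reflects-true⁻ (sat1-reflects (β t) a) β-holds)
              (_ , count-fin⁻ (trans (sym (rowSum≡ (δ t))) S≡k) , k∈)

    row-reflexive-elsewhere : ∀ π τ → FTP2.eqb τ ≡ true → vecEq (restrict τ) π ≡ false →
                              row π τ ≡ fin 0
    row-reflexive-elsewhere π τ τ-reflexive τ∉π = count-fin (HasSize-∅ λ { c refl →
      not-¬ τ∉π (reflects-true⁺ (vecEq-reflects _ π) (emitted-reflexive em c τ-reflexive)) })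

    ψ₅ : Ψ₅ φ assignment
    ψ₅ = row-reflexive-elsewhere
       , λ π → trans (sumT2-profile (emitted em) FTP2.eqb) (count-fin (emitted-reflexive-once em))

    solution : IsSolution φ assignment
    solution = ψ₁ , ψ₂ , ψ₃ , ψ₄ , ψ₅ , ((λ _ _ → fin<ℵ₀) , (λ _ _ → fin<ℵ₀))

lemma3 : ExcludedMiddle 0ℓ →
         {u b : ℕ} (φ : NormalForm u b) →
         (Σ (Structure u b) (λ 𝔄 → (𝔄 ⊨ φ) × GloballyHomogeneous 𝔄)) →
         Σ (Assignment φ) (λ s → IsSolution φ s)
lemma3 em φ (𝔄 , model , _) = assignment , solution
  where open Classical.Solution em φ 𝔄 model
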